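{- Work in $\mathbf{CZF}$ and assume finitary NID. Then for every set-presented formal space $(\mathbb P,\le,\triangleleft)$, the class of points of the formal space is set-generated (as a class of subsets of $\mathbb P$).
   Context: A formal space consists of a set $\mathbb P$ with a preorder $\le$ and a class relation $\triangleleft$ between elements of $\mathbb P$ and subsets of $\mathbb P$ ("$a$ is covered by $U$"; $\mathrm{Cov}(a)=\{U: a\triangleleft U\}$) such that: $a\in U$ implies $a\triangleleft U$; if $a\triangleleft U$ and $u\triangleleft V$ for all $u\in U$ then $a\triangleleft V$; if $a\le b$ and $b\triangleleft U$ then $a\triangleleft U$; if $a\triangleleft U$ and $a\triangleleft V$ then $a\triangleleft{\downarrow}U\cap{\downarrow}V$, where ${\downarrow}U=\{c: \exists u\in U\,c\le u\}$. It is set-presented if there is a function $\mathrm{BCov}$ assigning to each $a\in\mathbb P$ a set $\mathrm{BCov}(a)$ of subsets of $\mathbb P$ such that $a\triangleleft U$ iff $S\subseteq U$ for some $S\in\mathrm{BCov}(a)$. A point is an inhabited subset $\alpha\subseteq\mathbb P$ that is upwards closed, downwards directed (for $p,q\in\alpha$ there is $r\in\alpha$ with $r\le p$, $r\le q$), and such that $a\in\alpha$ and $a\triangleleft S$ imply $S\cap\alpha$ inhabited. A class $\mathcal C$ of subsets of a set $X$ is set-generated if there is a set $G\subseteq\mathcal C$ with $\forall\alpha\in\mathcal C\,\forall x\in\alpha\,\exists\beta\in G\,x\in\beta\subseteq\alpha$. Finitary NID: for every set $X$ and set $\mathcal R$ of finitary rules on $X$ (pairs $(a,b)$ of subsets of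 $X$ with $a$ the image of some $\{1,\dots,n\}$), the class of $Y\subseteq X$ closed under all rules ($a\subseteq Y$ implies $b\cap Y$ inhabited) is set-generated. -}

module Defs where

open import Level using (Level; _⊔_) renaming (suc to lsuc; zero to lzero)
open import Data.Nat using (ℕ)
open import Data.Fin using (Fin)
open import Data.Product using (Σ; _×_; _,_)

-- Sets of CZF are modelled by types in Set (Aczel's interpretation);
-- subsets of a set X are predicates X → Set; classes live in Set₁.

Subset : Set → Set₁
Subset X = X → Set

_∈_ : {X : Set} → X → Subset X → Set
x ∈ U = U x

_⊆_ : {X : Set} → Subset X → Subset X → Set
U ⊆ V = ∀ x → U x → V x

Inhabited : {X : Set} → Subset X → Set
Inhabited {X} U = Σ X λ x → U x

_∩_ : {X : Set} → Subset X → Subset X → Subset X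
(U ∩ V) x = U x × V x

SubsetClass : (ℓ : Level) → Set → Set (lsuc lzero ⊔ lsuc ℓ)
SubsetClass ℓ X = Subset X → Set ℓ

record SetGenerated {ℓ : Level} {X : Set} (𝒞 : SubsetClass ℓ X) : Set (lsuc lzero ⊔ ℓ) where
  field
    Idx     : Set
    gen     : Idx → Subset X
    gen∈𝒞   : ∀ i → 𝒞 (gen i)
    covers  : ∀ α → 𝒞 α → ∀ x → x ∈ α →
              Σ Idx λ i → (x ∈ gen i) × (gen i ⊆ α)

-- Finitary rules on X: pairs (a , b) with a the image of some {1,…,n}.
record FinitaryRule (X : Set) : Set₁ where
  field
    arity : ℕ
    prem  : Fin arity → X
    concl : Subset X

record RuleSet (X : Set) : Set₁ where
  field
    Idx  : Set
    rule : Idx → FinitaryRule X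

Closed : {X : Set} → RuleSet X → SubsetClass lzero X
Closed {X} R Y = ∀ j → (∀ k → prem (rule j) k ∈ Y) → Inhabited (concl (rule j) ∩ Y)
  where open RuleSet R
        open FinitaryRule

FinitaryNID : Set₁
FinitaryNID = (X : Set) (R : RuleSet X) → SetGenerated (Closed R)

Down : {P : Set} → (P → P → Set) → Subset P → Subset P
Down {P} _≤_ U c = Σ P λ u → U u × (c ≤ u)

-- Formal spaces ("a ◁ U" is a class relation, hence Set₁-valued)
record FormalSpace : Set₂ where
  field
    P      : Set
    _≤_    : P → P → Set
    ≤-refl  : ∀ {a} → a ≤ a
    ≤-trans : ∀ {a b c} → a ≤ b → b ≤ c → a ≤ c
    _◁_    : P → Subset P → Set₁
    ◁-refl  : ∀ {a U} → a ∈ U → a ◁ U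
    ◁-trans : ∀ {a U V} → a ◁ U → (∀ u → u ∈ U → u ◁ V) → a ◁ V
    ◁-≤     : ∀ {a b U} → a ≤ b → b ◁ U → a ◁ U
    ◁-∩     : ∀ {a U V} → a ◁ U → a ◁ V → a ◁ (Down _≤_ U ∩ Down _≤_ V)

record SetPresented (F : FormalSpace) : Set₁ where
  open FormalSpace F
  field
    BIdx  : P → Set
    BCov  : (a : P) → BIdx a → Subset P
    pres→ : ∀ a U → a ◁ U → Σ (BIdx a) λ i → BCov a i ⊆ U
    pres← : ∀ a U → (Σ (BIdx a) λ i → BCov a i ⊆ U) → a ◁ U

record IsPoint (F : FormalSpace) (α : Subset (FormalSpace.P F)) : Set₁ where
  open FormalSpace F
  field
    inhabited : Inhabited α
    upClosed  : ∀ {a b} → a ∈ α → a ≤ b → b ∈ α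
    directed  : ∀ {p q} → p ∈ α → q ∈ α → Σ P λ r → (r ∈ α) × (r ≤ p) × (r ≤ q)
    splitting : ∀ {a S} → a ∈ α → a ◁ S → Inhabited (S ∩ α)

Points : (F : FormalSpace) → SubsetClass (lsuc lzero) (FormalSpace.P F)
Points F = IsPoint F

-- The point axioms are themselves finitary rules on ℙ: inhabitedness is the rule
-- ∅ ⇒ ℙ, upward closure the rules {a} ⇒ {b} for a ≤ b, directedness the rules
-- {p, q} ⇒ ↓p ∩ ↓q, and, thanks to the set-presentation, the splitting condition
-- reduces to the set of rules {a} ⇒ S for S ∈ BCov(a).  So the points are exactly
-- the subsets closed under a set of finitary rules, which finitary NID makes
-- set-generated.
module Submission where

open import Data.Fin using (Fin; zero; suc)
open import Data.Product using (Σ; _×_; _,_)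
open import Data.Unit using (⊤; tt)
open import Relation.Binary.PropositionalEquality using (_≡_; refl)

open import Defs

SetGenerated-⇔ : ∀ {ℓ ℓ′} {X : Set} {𝒞 : SubsetClass ℓ X} {𝒟 : SubsetClass ℓ′ X} →
                 (∀ α → 𝒞 α → 𝒟 α) → (∀ α → 𝒟 α → 𝒞 α) →
                 SetGenerated 𝒞 → SetGenerated 𝒟
SetGenerated-⇔ 𝒞⊆𝒟 𝒟⊆𝒞 G = record
  { Idx    = Idx
  ; gen    = gen
  ; gen∈𝒞  = λ i → 𝒞⊆𝒟 (gen i) (gen∈𝒞 i)
  ; covers = λ α α∈𝒟 → covers α (𝒟⊆𝒞 α α∈𝒟)
  }
  where open SetGenerated G

module PointRules (F : FormalSpace) (SP : SetPresented F) where
  open FormalSpace F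
  open SetPresented SP

  data PointRule : Set where
    inhabitation : PointRule
    upward       : (a b : P) → a ≤ b → PointRule
    directedness : (p q : P) → PointRule
    splitting    : (a : P) → BIdx a → PointRule

  pair : P → P → Fin 2 → P
  pair p q zero    = p
  pair p q (suc _) = q

  pointRule : PointRule → FinitaryRule P
  pointRule inhabitation       = record { arity = 0 ; prem = λ ()       ; concl = λ _ → ⊤ }
  pointRule (upward a b _)     = record { arity = 1 ; prem = λ _ → a    ; concl = _≡ b }
  pointRule (directedness p q) = record { arity = 2 ; prem = pair p q   ; concl = λ r → r ≤ p × r ≤ q }
  pointRule (splitting a i)    = record { arity = 1 ; prem = λ _ → a    ; concl = BCov a i }

  pointRules : RuleSet P
  pointRules = record { Idx = PointRule ; rule = pointRule }

  closed⇒point : ∀ α → Closed pointRules α → IsPoint F α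
  closed⇒point α closed = record
    { inhabited = inhabited
    ; upClosed  = upClosed
    ; directed  = directed
    ; splitting = λ {a} a∈α a◁S → split a∈α (pres→ a _ a◁S)
    }
    where
      pair-∈ : ∀ {p q} → p ∈ α → q ∈ α → ∀ k → pair p q k ∈ α
      pair-∈ p∈α q∈α zero    = p∈α
      pair-∈ p∈α q∈α (suc _) = q∈α

      inhabited : Inhabited α
      inhabited with closed inhabitation (λ ())
      ... | x , _ , x∈α = x , x∈α

      upClosed : ∀ {a b} → a ∈ α → a ≤ b → b ∈ α
      upClosed {a} {b} a∈α a≤b with closed (upward a b a≤b) (λ _ → a∈α)
      ... | _ , refl , b∈α = b∈α

      directed : ∀ {p q} → p ∈ α → q ∈ α → Σ P λ r → (r ∈ α) × (r ≤ p) × (r ≤ q)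
      directed {p} {q} p∈α q∈α with closed (directedness p q) (pair-∈ p∈α q∈α)
      ... | r , (r≤p , r≤q) , r∈α = r , r∈α , r≤p , r≤q

      split : ∀ {a S} → a ∈ α → (Σ (BIdx a) λ i → BCov a i ⊆ S) → Inhabited (S ∩ α)
      split {a} a∈α (i , Bᵢ⊆S) with closed (splitting a i) (λ _ → a∈α)
      ... | x , x∈Bᵢ , x∈α = x , Bᵢ⊆S x x∈Bᵢ , x∈α

  point⇒closed : ∀ α → IsPoint F α → Closed pointRules α
  point⇒closed α pt inhabitation _ with IsPoint.inhabited pt
  ... | x , x∈α = x , tt , x∈α
  point⇒closed α pt (upward a b a≤b) prem∈α = b , refl , IsPoint.upClosed pt (prem∈α zero) a≤b
  point⇒closed α pt (directedness p q) prem∈α with IsPoint.directed pt (prem∈α zero) (prem∈α (suc zero))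
  ... | r , r∈α , r≤p , r≤q = r , (r≤p , r≤q) , r∈α
  point⇒closed α pt (splitting a i) prem∈α =
    IsPoint.splitting pt (prem∈α zero) (pres← a (BCov a i) (i , λ _ x∈Bᵢ → x∈Bᵢ))

theorem5p1 : FinitaryNID → (F : FormalSpace) → SetPresented F → SetGenerated (Points F)
theorem5p1 nid F SP =
  SetGenerated-⇔ closed⇒point point⇒closed (nid (FormalSpace.P F) pointRules)
  where open PointRules F SP
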